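{- Define instruction sequences $P^0_n$ for $n\in\mathbb{N}$ by $P^0_0 = \,!$, $P^0_1 = {+}\mathrm{in}{:}1.\mathrm{get} \,;\, \mathrm{out}.\mathrm{set}{:}\mathrm{T} \,;\, !$, and for $n\ge 2$ $$P^0_n = {+}\mathrm{in}{:}1.\mathrm{get} \;;\; \mathop{;}_{i=2}^{n}\bigl(\#4 \,;\, {+}\mathrm{in}{:}i.\mathrm{get} \,;\, \#3 \,;\, \#3 \,;\, { - }\mathrm{in}{:}i.\mathrm{get}\bigr) \;;\; \mathrm{out}.\mathrm{set}{:}\mathrm{T} \;;\; !,$$ where $\mathop{;}_{i=2}^{n} Q_i$ denotes the concatenation $Q_2;Q_3;\dots;Q_n$. Then for each $n\in\mathbb{N}$, $P^0_n$ computes the $n$-ary parity function $\mathrm{PAR}_n$.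
   Context: Booleans are $\mathrm{F}$ and $\mathrm{T}$. An instruction sequence is a finite sequence $u_1;u_2;\dots;u_k$ of primitive instructions; its length is $k$. Basic instructions are: $\mathrm{in}{:}i.\mathrm{get}$ ($i\ge1$), $\mathrm{out}.\mathrm{set}{:}b$ ($b\in\{\mathrm{F},\mathrm{T}\}$), $\mathrm{aux}{:}i.\mathrm{get}$, $\mathrm{aux}{:}i.\mathrm{set}{:}b$, $\mathrm{aux}{:}i.\mathrm{com}$ ($i\ge1$, $b\in\{\mathrm{F},\mathrm{T}\}$). Each names a Boolean register ($\mathrm{in}{:}i$ = $i$th input register, $\mathrm{out}$ = output register, $\mathrm{aux}{:}i$ = $i$th auxiliary register) and a command: $\mathrm{get}$ leaves the register unchanged and replies its content; $\mathrm{set}{:}b$ sets the content to $b$ and replies $b$; $\mathrm{com}$ complements the content and replies the new content. Primitive instructions are: for each basic instruction $a$, a plain instruction $a$, a positive test ${+}a$ and a negative test ${ - }a$; for each $l\in\mathbb{N}$ a forward jump $\#l$; and the termination instruction $!$. Execution starts at $u_1$. ${+}a$ executes $a$ and proceeds with the next instruction if the reply is $\mathrm{T}$, otherwise skips the next instruction and proceeds with the one after it; ${ - }a$ is the same with the roles of the replies reversed; plain $a$ executes $a$ and always proceeds with the next instruction; $\#l$ proceeds with the $l$th next instruction; $!$ terminates execution. If $l=0$ or there is no instruction to proceed with, inaction occurs (execution does not terminate). An instruction sequence $X$ computes $f:\{\mathrm{F},\mathrm{T}\}^n\to\{\mathrm{F},\mathrm{T}\}$ if there is $k\in\mathbb{N}$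 (at least every auxiliary index used in $X$) such that for all $b_1,\dots,b_n$: when execution of $X$ starts with $\mathrm{in}{:}i$ containing $b_i$ ($1\le i\le n$), $\mathrm{out}$ containing $\mathrm{F}$, and $\mathrm{aux}{:}1,\dots,\mathrm{aux}{:}k$ containing $\mathrm{F}$, execution terminates and the content of $\mathrm{out}$ at termination is $f(b_1,\dots,b_n)$. The $n$-ary parity function $\mathrm{PAR}_n:\{\mathrm{F},\mathrm{T}\}^n\to\{\mathrm{F},\mathrm{T}\}$ has $\mathrm{PAR}_n(b_1,\dots,b_n)=\mathrm{T}$ iff the number of $\mathrm{T}$'s among $b_1,\dots,b_n$ is odd. -}

module Defs where

open import Data.Bool using (Bool; true; false; not; if_then_else_)
open import Data.Nat using (ℕ; zero; suc; _+_; _≤_; _⊔_; _%_)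
open import Data.Nat as ℕ using (_≡ᵇ_)
open import Data.Fin using (Fin; toℕ)
open import Data.Vec using (Vec; lookup; []; _∷_)
open import Data.List using (List; []; _∷_; _++_; drop; concat; map; upTo)
open import Data.Product using (_×_; _,_; proj₁; proj₂; ∃)
open import Relation.Binary.PropositionalEquality using (_≡_)

-- Basic instructions (indices i are natural numbers; the paper requires i ≥ 1,
-- and all instructions used below respect that).
data Basic : Set where
  in-get   : ℕ → Basic
  out-set  : Bool → Basic
  aux-get  : ℕ → Basic
  aux-set  : ℕ → Bool → Basic
  aux-com  : ℕ → Basic

data Instr : Set where
  plain : Basic → Instr
  pos   : Basic → Instr
  neg   : Basic → Instr
  jmp   : ℕ → Instr
  halt  : Instr

InstrSeq : Set
InstrSeq = List Instr

record State : Set where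
  constructor st
  field
    inp : ℕ → Bool
    out : Bool
    aux : ℕ → Bool
open State public

update : (ℕ → Bool) → ℕ → Bool → ℕ → Bool
update f i b j = if i ≡ᵇ j then b else f j

effect : Basic → State → Bool × State
effect (in-get i)    s = inp s i , s
effect (out-set b)   s = b , st (inp s) b (aux s)
effect (aux-get i)   s = aux s i , s
effect (aux-set i b) s = b , st (inp s) (out s) (update (aux s) i b)
effect (aux-com i)   s = not (aux s i) , st (inp s) (out s) (update (aux s) i (not (aux s i)))

-- Proceeding with an instruction that does not exist (running off the
-- end) or #0 yields inaction, i.e. no derivation.
data Exec : InstrSeq → State → State → Set where
  ex-halt  : ∀ {xs s} → Exec (halt ∷ xs) s s
  ex-plain : ∀ {a xs s s'} →
             Exec xs (proj₂ (effect a s)) s' → Exec (plain a ∷ xs) s s'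
  ex-pos-T : ∀ {a xs s t s'} → effect a s ≡ (true , t) →
             Exec xs t s' → Exec (pos a ∷ xs) s s'
  ex-pos-F : ∀ {a xs s t s'} → effect a s ≡ (false , t) →
             Exec (drop 1 xs) t s' → Exec (pos a ∷ xs) s s'
  ex-neg-F : ∀ {a xs s t s'} → effect a s ≡ (false , t) →
             Exec xs t s' → Exec (neg a ∷ xs) s s'
  ex-neg-T : ∀ {a xs s t s'} → effect a s ≡ (true , t) →
             Exec (drop 1 xs) t s' → Exec (neg a ∷ xs) s s'
  ex-jmp   : ∀ {l xs s s'} →
             Exec (drop l xs) s s' → Exec (jmp (suc l) ∷ xs) s s'

auxIdxB : Basic → ℕ
auxIdxB (aux-get i)   = i
auxIdxB (aux-set i _) = i
auxIdxB (aux-com i)   = i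
auxIdxB _             = 0

auxIdxI : Instr → ℕ
auxIdxI (plain a) = auxIdxB a
auxIdxI (pos a)   = auxIdxB a
auxIdxI (neg a)   = auxIdxB a
auxIdxI _         = 0

maxAux : InstrSeq → ℕ
maxAux []       = 0
maxAux (u ∷ xs) = auxIdxI u ⊔ maxAux xs

Computes : (n : ℕ) → InstrSeq → (Vec Bool n → Bool) → Set
Computes n X f =
  ∃ λ (k : ℕ) → maxAux X ≤ k ×
    (∀ (b : Vec Bool n) (s : State) →
       (∀ (i : Fin n) → inp s (suc (toℕ i)) ≡ lookup b i) →
       out s ≡ false →
       (∀ (j : ℕ) → 1 ≤ j → j ≤ k → aux s j ≡ false) →
       ∃ λ (s' : State) → Exec X s s' × out s' ≡ f b)

countT : ∀ {n} → Vec Bool n → ℕ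
countT []           = 0
countT (true ∷ bs)  = suc (countT bs)
countT (false ∷ bs) = countT bs

PAR : (n : ℕ) → Vec Bool n → Bool
PAR n b = (countT b % 2) ≡ᵇ 1

block : ℕ → InstrSeq
block i = jmp 4 ∷ pos (in-get i) ∷ jmp 3 ∷ jmp 3 ∷ neg (in-get i) ∷ []

P0 : ℕ → InstrSeq
P0 zero          = halt ∷ []
P0 (suc zero)    = pos (in-get 1) ∷ plain (out-set true) ∷ halt ∷ []
P0 (suc (suc m)) =
  pos (in-get 1) ∷
  (concat (map (λ j → block (2 + j)) (upTo (suc m)))
   ++ (plain (out-set true) ∷ halt ∷ []))

module Submission where

-- The program keeps the parity of the inputs read so far in its control
-- state: before each block "#4 ; +in:i.get ; #3 ; #3 ; -in:i.get" execution
-- stands on the leading #4 when the running parity is T and on the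
-- instruction after it when the parity is F.

open import Defs
open import Data.Nat using (ℕ; zero; suc; _+_; _%_; _≡ᵇ_)
open import Data.Nat.Properties using (≤-refl)
open import Data.Bool using (Bool; true; false; not; _∨_; _xor_)
open import Data.Bool.Properties using (xor-assoc; ∨-identityʳ)
import Data.Fin as Fin
open Fin using (toℕ)
open import Data.Vec using (Vec; lookup; toList; []; _∷_)
open import Data.List using (List; []; _∷_; _++_; drop; concat; map; foldr; upTo; applyUpTo)
open import Data.List.Properties using (map-upTo)
open import Data.Product using (_×_; _,_; ∃)
open import Relation.Binary.PropositionalEquality using (_≡_; refl; cong; cong₂; sym; trans; subst; module ≡-Reasoning)

parity : List Bool → Bool
parity = foldr _xor_ false

-- Where execution resumes in L when the running parity is p.
enter : Bool → InstrSeq → InstrSeq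
enter true  L = L
enter false L = drop 1 L

test-pos : ∀ {i L s s'} → Exec (enter (inp s i) L) s s' → Exec (pos (in-get i) ∷ L) s s'
test-pos {i} {s = s} run with inp s i in reply
... | true  = ex-pos-T (cong (_, s) reply) run
... | false = ex-pos-F (cong (_, s) reply) run

test-neg : ∀ {i L s s'} → Exec (enter (not (inp s i)) L) s s' → Exec (neg (in-get i) ∷ L) s s'
test-neg {i} {s = s} run with inp s i in reply
... | true  = ex-neg-T (cong (_, s) reply) run
... | false = ex-neg-F (cong (_, s) reply) run

skip-pair : ∀ p {a L s s'} → Exec (enter p L) s s' → Exec (enter p (jmp 3 ∷ jmp 3 ∷ a ∷ L)) s s'
skip-pair true  run = ex-jmp run
skip-pair false run = ex-jmp run

block-step : ∀ p i {L s s'} → Exec (enter (p xor inp s i) L) s s' → Exec (enter p (block i ++ L)) s s'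
block-step true  i         run = ex-jmp (test-neg run)
block-step false i {s = s} run = test-pos (skip-pair (inp s i) run)

blocks : List ℕ → InstrSeq
blocks js = concat (map (λ j → block (2 + j)) js)

run-blocks : ∀ js p {L s s'} →
  Exec (enter (p xor parity (map (λ j → inp s (2 + j)) js)) L) s s' →
  Exec (enter p (blocks js ++ L)) s s'
run-blocks []       p {L} run = subst (λ q → Exec (enter q L) _ _) (xor-false p) run
  where
  xor-false : ∀ q → q xor false ≡ q
  xor-false true  = refl
  xor-false false = refl
run-blocks (j ∷ js) p {L} {s} run =
  block-step p (2 + j) (run-blocks js (p xor inp s (2 + j))
    (subst (λ q → Exec (enter q L) s _) (sym (xor-assoc p _ _)) run))

tail : InstrSeq
tail = plain (out-set true) ∷ halt ∷ []

run-tail : ∀ p s → ∃ λ s' → Exec (enter p tail) s s' × out s' ≡ p ∨ out s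
run-tail true  s = st (inp s) true (aux s) , ex-plain ex-halt , refl
run-tail false s = s , ex-halt , refl

P0-shape : ∀ m → P0 (suc m) ≡ pos (in-get 1) ∷ (blocks (upTo m) ++ tail)
P0-shape zero    = refl
P0-shape (suc m) = refl

P0-runs : ∀ m s → ∃ λ s' → Exec (P0 (suc m)) s s' ×
  out s' ≡ parity (applyUpTo (λ j → inp s (suc j)) (suc m)) ∨ out s
P0-runs m s with run-tail (parity (inp s 1 ∷ map (λ j → inp s (2 + j)) (upTo m))) s
... | s' , run , out≡ =
  s' ,
  subst (λ X → Exec X s s') (sym (P0-shape m)) (test-pos (run-blocks (upTo m) (inp s 1) run)) ,
  subst (λ xs → out s' ≡ parity (inp s 1 ∷ xs) ∨ out s) (map-upTo (λ j → inp s (2 + j)) m) out≡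

readings : ∀ {n} (r : ℕ → Bool) (b : Vec Bool n) →
  (∀ i → r (toℕ i) ≡ lookup b i) → applyUpTo r n ≡ toList b
readings r []      agree = refl
readings r (x ∷ b) agree =
  cong₂ _∷_ (agree Fin.zero) (readings (λ j → r (suc j)) b (λ i → agree (Fin.suc i)))

odd-suc : ∀ c → (suc c % 2 ≡ᵇ 1) ≡ not (c % 2 ≡ᵇ 1)
odd-suc zero          = refl
odd-suc (suc zero)    = refl
odd-suc (suc (suc c)) = odd-suc c

PAR-parity : ∀ {n} (b : Vec Bool n) → PAR n b ≡ parity (toList b)
PAR-parity []           = refl
PAR-parity (true ∷ bs)  = trans (odd-suc (countT bs)) (cong not (PAR-parity bs))
PAR-parity (false ∷ bs) = PAR-parity bs

proposition1 : (n : ℕ) → Computes n (P0 n) (PAR n)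
proposition1 zero    = maxAux (P0 zero) , ≤-refl , λ { [] s _ out≡F _ → s , ex-halt , out≡F }
proposition1 (suc m) = maxAux (P0 (suc m)) , ≤-refl , λ b s agree out≡F _ → computes b s agree out≡F
  where
  computes : ∀ b s → (∀ i → inp s (suc (toℕ i)) ≡ lookup b i) → out s ≡ false →
             ∃ λ s' → Exec (P0 (suc m)) s s' × out s' ≡ PAR (suc m) b
  computes b s agree out≡F with P0-runs m s
  ... | s' , run , out≡ = s' , run , (begin
    out s'                                         ≡⟨ out≡ ⟩
    parity (applyUpTo input (suc m)) ∨ out s       ≡⟨ cong (parity (applyUpTo input (suc m)) ∨_) out≡F ⟩
    parity (applyUpTo input (suc m)) ∨ false       ≡⟨ ∨-identityʳ _ ⟩
    parity (applyUpTo input (suc m))               ≡⟨ cong parity (readings input b agree) ⟩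
    parity (toList b)                              ≡⟨ sym (PAR-parity b) ⟩
    PAR (suc m) b                                  ∎)
    where
    open ≡-Reasoning
    input : ℕ → Bool
    input j = inp s (suc j)
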